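{- Let $N$ be a natural number such that $N$ cannot be written as a sum of two squares, and $N=2m$ for some odd integer $m$. Then $$\nu_2(N)+\sum_{1\le k<\sqrt N}\sigma_0(N-k^2)+\frac12\sigma_1(N)\equiv 0\pmod 4,$$ where the sum runs over positive integers $k<\sqrt N$.
   Context: For a positive integer $m$, $\sigma_0(m)$ is the number of positive divisors of $m$ and $\sigma_1(m)$ is the sum of the positive divisors of $m$. $\nu_2(N)$ denotes the number of partitions of $N$ in which exactly two distinct part sizes appear, i.e. the number of tuples $(n_1,\dots,n_1,n_2,\dots,n_2)$ with $n_1>n_2\ge 1$, $n_1$ appearing $k_1\ge1$ times and $n_2$ appearing $k_2\ge 1$ times, and $k_1n_1+k_2n_2=N$. -}

module Defs where

open import Data.Nat using (ℕ; zero; suc; _+_; _*_; _∸_; _<_; _<?_)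
open import Data.Nat.Divisibility using (_∣_; _∣?_)
open import Data.Nat.ListAction using (sum)
open import Data.List using (List; []; _∷_; length; map; filter; upTo; concatMap)
open import Data.Product using (_×_; _,_)
open import Relation.Nullary using (Dec; yes; no)
open import Relation.Binary.PropositionalEquality using (_≡_)
open import Data.Nat using (_≟_)

range1 : ℕ → List ℕ
range1 n = map suc (upTo n)

divisors : ℕ → List ℕ
divisors m = filter (λ d → d ∣? m) (range1 m)

σ₀ : ℕ → ℕ
σ₀ m = length (divisors m)

σ₁ : ℕ → ℕ
σ₁ m = sum (divisors m)

quadruples : ℕ → List (ℕ × ℕ × ℕ × ℕ)
quadruples N =
  concatMap (λ n₁ → concatMap (λ n₂ → concatMap (λ k₁ → map (λ k₂ → (n₁ , n₂ , k₁ , k₂))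
    (range1 N)) (range1 N)) (range1 N)) (range1 N)

-- the defining condition: n₁ > n₂ ≥ 1, k₁, k₂ ≥ 1 (ensured by range1), k₁n₁ + k₂n₂ = N
twoPartCond : ℕ → ℕ × ℕ × ℕ × ℕ → Set
twoPartCond N (n₁ , n₂ , k₁ , k₂) = (n₂ < n₁) × (k₁ * n₁ + k₂ * n₂ ≡ N)

twoPartCond? : (N : ℕ) → (q : ℕ × ℕ × ℕ × ℕ) → Dec (twoPartCond N q)
twoPartCond? N (n₁ , n₂ , k₁ , k₂) with n₂ <? n₁ | k₁ * n₁ + k₂ * n₂ ≟ N
... | yes p | yes q = yes (p , q)
... | no ¬p | _ = no (λ { (p , _) → ¬p p })
... | yes _ | no ¬q = no (λ { (_ , q) → ¬q q })

-- ν₂(N): number of partitions of N with exactly two distinct part sizes.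
-- Every such tuple has all components in [1, N], so enumerating [1, N]^4 is complete.
ν₂ : ℕ → ℕ
ν₂ N = length (filter (twoPartCond? N) (quadruples N))

-- Σ_{1 ≤ k < √N} σ₀(N - k²); the condition k < √N is k² < N, and such k lie in [1, N].
sumσ₀ : ℕ → ℕ
sumσ₀ N = sum (map (λ k → σ₀ (N ∸ k * k)) (filter (λ k → k * k <? N) (range1 N)))

-- Let W be the number of solutions of N = ab + cd in positive integers.  Reading a solution
-- as a two-part-size partition k₁n₁ + k₂n₂ and comparing n₁ with n₂ gives
-- W = 2ν₂(N) + σ₁(N) − σ₀(N), the last two terms counting the solutions with n₁ = n₂, i.e. the
-- ways to write N/n as a sum of two positive multiplicities.  On the other hand, split W
-- successively along the involutions a ↔ b, c ↔ d and (a, b) ↔ (c, d), each time into two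
-- mirror halves plus the fixed points.  Since N is not a sum of two squares, the fixed points
-- are the solutions of N = k² + cd, which are Σₖ σ₀(N − k²) in number and pair up under
-- c ↔ d, and those of N = 2ab, which are σ₀(m) = σ₀(N)/2 in number (m odd) and pair up under
-- a ↔ b.  This gives W ≡ 2 Σₖ σ₀(N − k²) + σ₀(N) (mod 8) with σ₀(N) ≡ 0 (mod 4) and
-- Σₖ σ₀(N − k²) even, and comparing with the first expression for W yields the congruence.
module Submission where

open import Defs
open import Data.Empty using (⊥-elim)
open import Data.List using (List; []; _∷_; [_]; _++_; map; filter; upTo; concatMap; length)
open import Data.List.Properties using (upTo-∷ʳ; map-++; map-∘; map-id)
open import Data.Nat using (ℕ; zero; suc; pred; _+_; _*_; _∸_; _≤_; _<_; z≤n; s≤s; _≟_; _<?_; >-nonZero)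
open import Data.Nat.Divisibility
  using (_∣_; _∣?_; divides; ∣⇒≤; m∣m*n; *-pres-∣; *-cancelˡ-∣; _∣0; n∣m⇒m%n≡0)
open import Data.Nat.DivMod using (_/_; _%_; m*n/n≡m; m*n%n≡0; +-distrib-/-∣ˡ)
open import Data.Nat.ListAction using (sum)
open import Data.Nat.ListAction.Properties using (sum-++)
open import Data.Nat.Primality using (euclidsLemma; prime[2])
open import Data.Nat.Properties
open import Data.Nat.Tactic.RingSolver using (solve-∀)
open import Data.Product using (_×_; ∃-syntax; _,_)
open import Data.Sum using ([_,_]′; inj₁; inj₂)
open import Function using (_∘_)
open import Level using (Level)
open import Relation.Binary.Definitions using (Tri; tri<; tri≈; tri>)
open import Relation.Binary.PropositionalEquality hiding ([_])
open import Relation.Nullary using (Dec; yes; no; ¬_)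
open import Algebra.Properties.CommutativeSemigroup +-commutativeSemigroup
  using (interchange; xy∙z≈xz∙y)
open import Algebra.Properties.CommutativeSemigroup *-commutativeSemigroup
  using () renaming (x∙yz≈y∙xz to m*[n*o]≡n*[m*o])

private variable
  ℓ : Level
  P Q : Set ℓ
  A B : Set

⟦_⟧ : Dec P → ℕ
⟦ yes _ ⟧ = 1
⟦ no  _ ⟧ = 0

⟦⟧-yes : (P? : Dec P) → P → ⟦ P? ⟧ ≡ 1
⟦⟧-yes (yes _)  _ = refl
⟦⟧-yes (no ¬p)  p = ⊥-elim (¬p p)

⟦⟧-no : (P? : Dec P) → ¬ P → ⟦ P? ⟧ ≡ 0
⟦⟧-no (yes p) ¬p = ⊥-elim (¬p p)
⟦⟧-no (no _)  _  = refl

⟦⟧-⇔ : (P? : Dec P) (Q? : Dec Q) → (P → Q) → (Q → P) → ⟦ P? ⟧ ≡ ⟦ Q? ⟧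
⟦⟧-⇔ (yes p) Q? to _    = sym (⟦⟧-yes Q? (to p))
⟦⟧-⇔ (no ¬p) Q? _  from = sym (⟦⟧-no Q? (¬p ∘ from))

⟦⟧-idem : (P? : Dec P) (x : ℕ) → ⟦ P? ⟧ * (⟦ P? ⟧ * x) ≡ ⟦ P? ⟧ * x
⟦⟧-idem (yes _) x = cong (_+ 0) (+-identityʳ x)
⟦⟧-idem (no _)  x = refl

-- The index of ∑[ i ≤ n ] runs over 1 ≤ i ≤ n, matching range1 in Defs.
∑ : ℕ → (ℕ → ℕ) → ℕ
∑ zero    f = 0
∑ (suc n) f = ∑ n f + f (suc n)

syntax ∑ n (λ i → e) = ∑[ i ≤ n ] e

∑² : ℕ → (ℕ → ℕ → ℕ) → ℕ
∑² n F = ∑[ x ≤ n ] ∑[ y ≤ n ] F x y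

∑-cong-∈ : ∀ n {f g : ℕ → ℕ} → (∀ {i} → 1 ≤ i → i ≤ n → f i ≡ g i) → ∑ n f ≡ ∑ n g
∑-cong-∈ zero    eq = refl
∑-cong-∈ (suc n) eq =
  cong₂ _+_ (∑-cong-∈ n (λ 1≤i i≤n → eq 1≤i (m≤n⇒m≤1+n i≤n))) (eq (s≤s z≤n) ≤-refl)

∑-cong : ∀ n {f g : ℕ → ℕ} → (∀ i → f i ≡ g i) → ∑ n f ≡ ∑ n g
∑-cong n eq = ∑-cong-∈ n (λ {i} _ _ → eq i)

∑²-cong : ∀ n {F G : ℕ → ℕ → ℕ} → (∀ x y → F x y ≡ G x y) → ∑² n F ≡ ∑² n G
∑²-cong n eq = ∑-cong n (λ x → ∑-cong n (eq x))

∑-zero : ∀ n → ∑[ i ≤ n ] 0 ≡ 0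
∑-zero zero    = refl
∑-zero (suc n) = trans (+-identityʳ _) (∑-zero n)

∑-zero-∈ : ∀ n {f : ℕ → ℕ} → (∀ {i} → 1 ≤ i → i ≤ n → f i ≡ 0) → ∑ n f ≡ 0
∑-zero-∈ n eq = trans (∑-cong-∈ n eq) (∑-zero n)

∑²-zero : ∀ n {F : ℕ → ℕ → ℕ} → (∀ x y → F x y ≡ 0) → ∑² n F ≡ 0
∑²-zero n eq = trans (∑-cong n (λ x → trans (∑-cong n (eq x)) (∑-zero n))) (∑-zero n)

∑-one : ∀ n → ∑[ i ≤ n ] 1 ≡ n
∑-one zero    = refl
∑-one (suc n) = trans (cong (_+ 1) (∑-one n)) (+-comm n 1)

∑-distrib-+ : ∀ n (f g : ℕ → ℕ) → ∑[ i ≤ n ] (f i + g i) ≡ ∑ n f + ∑ n g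
∑-distrib-+ zero    f g = refl
∑-distrib-+ (suc n) f g =
  trans (cong (_+ (f (suc n) + g (suc n))) (∑-distrib-+ n f g))
        (interchange (∑ n f) (∑ n g) (f (suc n)) (g (suc n)))

∑²-distrib-+ : ∀ n (F G : ℕ → ℕ → ℕ) → ∑² n (λ x y → F x y + G x y) ≡ ∑² n F + ∑² n G
∑²-distrib-+ n F G = trans (∑-cong n (λ x → ∑-distrib-+ n (F x) (G x))) (∑-distrib-+ n _ _)

*-distribˡ-∑ : ∀ n c (f : ℕ → ℕ) → c * ∑ n f ≡ ∑[ i ≤ n ] (c * f i)
*-distribˡ-∑ zero    c f = *-zeroʳ c
*-distribˡ-∑ (suc n) c f =
  trans (*-distribˡ-+ c (∑ n f) (f (suc n))) (cong (_+ c * f (suc n)) (*-distribˡ-∑ n c f))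

*-distribʳ-∑ : ∀ n c (f : ℕ → ℕ) → ∑ n f * c ≡ ∑[ i ≤ n ] (f i * c)
*-distribʳ-∑ n c f =
  trans (*-comm (∑ n f) c) (trans (*-distribˡ-∑ n c f) (∑-cong n (λ i → *-comm c (f i))))

*-distribˡ-∑² : ∀ n c (F : ℕ → ℕ → ℕ) → c * ∑² n F ≡ ∑² n (λ x y → c * F x y)
*-distribˡ-∑² n c F = trans (*-distribˡ-∑ n c _) (∑-cong n (λ x → *-distribˡ-∑ n c (F x)))

∑-comm : ∀ m n (F : ℕ → ℕ → ℕ) → ∑[ x ≤ m ] ∑[ y ≤ n ] F x y ≡ ∑[ y ≤ n ] ∑[ x ≤ m ] F x y
∑-comm zero    n F = sym (∑-zero n)
∑-comm (suc m) n F = begin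
  ∑[ x ≤ m ] ∑[ y ≤ n ] F x y + ∑[ y ≤ n ] F (suc m) y ≡⟨ cong (_+ ∑[ y ≤ n ] F (suc m) y) (∑-comm m n F) ⟩
  ∑[ y ≤ n ] ∑[ x ≤ m ] F x y + ∑[ y ≤ n ] F (suc m) y ≡⟨ ∑-distrib-+ n _ _ ⟨
  ∑[ y ≤ n ] (∑[ x ≤ m ] F x y + F (suc m) y)          ∎
  where open ≡-Reasoning

∑-δ : ∀ n {a} (f : ℕ → ℕ) → 1 ≤ a → a ≤ n → ∑[ i ≤ n ] (⟦ i ≟ a ⟧ * f i) ≡ f a
∑-δ zero    f 1≤a a≤0 = ⊥-elim (<-irrefl refl (≤-trans 1≤a a≤0))
∑-δ (suc n) {a} f 1≤a a≤n+1 with suc n ≟ a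
... | yes refl = begin
  ∑[ i ≤ n ] (⟦ i ≟ suc n ⟧ * f i) + (f (suc n) + 0) ≡⟨ cong₂ _+_ (∑-zero-∈ n off-diagonal) (+-identityʳ _) ⟩
  f (suc n)                                          ∎
  where
  open ≡-Reasoning
  off-diagonal : ∀ {i} → 1 ≤ i → i ≤ n → ⟦ i ≟ suc n ⟧ * f i ≡ 0
  off-diagonal {i} _ i≤n = cong (_* f i) (⟦⟧-no (i ≟ suc n) (λ { refl → <-irrefl refl i≤n }))
... | no n+1≢a =
  trans (+-identityʳ _) (∑-δ n f 1≤a (≤-pred (≤∧≢⇒< a≤n+1 (n+1≢a ∘ sym))))

∑-truncate : ∀ {m} n (f : ℕ → ℕ) → m ≤ n → (∀ {i} → m < i → i ≤ n → f i ≡ 0) → ∑ n f ≡ ∑ m f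
∑-truncate n f m≤n vanish with m≤n⇒m<n∨m≡n m≤n
... | inj₂ refl = refl
∑-truncate {m} (suc n) f _ vanish | inj₁ (s≤s m≤n) = begin
  ∑ n f + f (suc n) ≡⟨ cong₂ _+_ (∑-truncate n f m≤n (λ m<i i≤n → vanish m<i (m≤n⇒m≤1+n i≤n)))
                                 (vanish (s≤s m≤n) ≤-refl) ⟩
  ∑ m f + 0         ≡⟨ +-identityʳ _ ⟩
  ∑ m f             ∎
  where open ≡-Reasoning

range1-suc : ∀ n → range1 (suc n) ≡ range1 n ++ [ suc n ]
range1-suc n = trans (cong (map suc) (sym (upTo-∷ʳ n))) (map-++ suc (upTo n) [ n ])

sum-map-range1 : ∀ n (f : ℕ → ℕ) → sum (map f (range1 n)) ≡ ∑ n f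
sum-map-range1 zero    f = refl
sum-map-range1 (suc n) f = begin
  sum (map f (range1 (suc n)))             ≡⟨ cong (sum ∘ map f) (range1-suc n) ⟩
  sum (map f (range1 n ++ [ suc n ]))      ≡⟨ cong sum (map-++ f (range1 n) [ suc n ]) ⟩
  sum (map f (range1 n) ++ [ f (suc n) ])  ≡⟨ sum-++ (map f (range1 n)) [ f (suc n) ] ⟩
  sum (map f (range1 n)) + (f (suc n) + 0) ≡⟨ cong₂ _+_ (sum-map-range1 n f) (+-identityʳ _) ⟩
  ∑ n f + f (suc n)                        ∎
  where open ≡-Reasoning

sum-map-filter : ∀ {P : A → Set ℓ} (P? : ∀ x → Dec (P x)) (g : A → ℕ) xs →
                 sum (map g (filter P? xs)) ≡ sum (map (λ x → ⟦ P? x ⟧ * g x) xs)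
sum-map-filter P? g []       = refl
sum-map-filter P? g (x ∷ xs) with P? x
... | yes _ = cong₂ _+_ (sym (+-identityʳ (g x))) (sum-map-filter P? g xs)
... | no  _ = sum-map-filter P? g xs

length-filter : ∀ {P : A → Set ℓ} (P? : ∀ x → Dec (P x)) xs →
                length (filter P? xs) ≡ sum (map (λ x → ⟦ P? x ⟧) xs)
length-filter P? []       = refl
length-filter P? (x ∷ xs) with P? x
... | yes _ = cong suc (length-filter P? xs)
... | no  _ = length-filter P? xs

length-as-sum : (xs : List A) → length xs ≡ sum (map (λ _ → 1) xs)
length-as-sum []       = refl
length-as-sum (x ∷ xs) = cong suc (length-as-sum xs)

sum-map-concatMap : ∀ (g : B → ℕ) (f : A → List B) xs →
                    sum (map g (concatMap f xs)) ≡ sum (map (λ x → sum (map g (f x))) xs)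
sum-map-concatMap g f []       = refl
sum-map-concatMap g f (x ∷ xs) = begin
  sum (map g (f x ++ concatMap f xs))              ≡⟨ cong sum (map-++ g (f x) _) ⟩
  sum (map g (f x) ++ map g (concatMap f xs))      ≡⟨ sum-++ (map g (f x)) _ ⟩
  sum (map g (f x)) + sum (map g (concatMap f xs)) ≡⟨ cong (sum (map g (f x)) +_) (sum-map-concatMap g f xs) ⟩
  sum (map g (f x)) + sum (map (λ y → sum (map g (f y))) xs) ∎
  where open ≡-Reasoning

sum-map-quadruples : ∀ N (g : ℕ × ℕ × ℕ × ℕ → ℕ) →
  sum (map g (quadruples N)) ≡ ∑² N (λ n₁ n₂ → ∑² N (λ k₁ k₂ → g (n₁ , n₂ , k₁ , k₂)))
sum-map-quadruples N g =
  trans (unfold _) (∑-cong N λ n₁ → trans (unfold _) (∑-cong N λ n₂ → trans (unfold _) (∑-cong N λ k₁ →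
    trans (cong sum (sym (map-∘ (range1 N)))) (sum-map-range1 N _))))
  where
  unfold : (f : ℕ → List (ℕ × ℕ × ℕ × ℕ)) →
           sum (map g (concatMap f (range1 N))) ≡ ∑[ i ≤ N ] sum (map g (f i))
  unfold f = trans (sum-map-concatMap g f (range1 N)) (sum-map-range1 N _)

cofactor≤ : ∀ {d x q} → 1 ≤ d → x ≡ q * d → q ≤ x
cofactor≤ {suc _} {q = q} _ x≡qd = ≤-trans (m≤m*n q _) (≤-reflexive (sym x≡qd))

∑-multiples : ∀ R {d x q₀} (w : ℕ → ℕ) → 1 ≤ d → 1 ≤ x → x ≤ R → x ≡ q₀ * d →
              ∑[ q ≤ R ] (⟦ q * d ≟ x ⟧ * w q) ≡ w q₀
∑-multiples R {d@(suc _)} {x} {q₀} w 1≤d 1≤x x≤R x≡q₀d = begin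
  ∑[ q ≤ R ] (⟦ q * d ≟ x ⟧ * w q) ≡⟨ ∑-cong R (λ q → cong (_* w q) (⟦⟧-⇔ (q * d ≟ x) (q ≟ q₀) (to q) from)) ⟩
  ∑[ q ≤ R ] (⟦ q ≟ q₀ ⟧ * w q)    ≡⟨ ∑-δ R w 1≤q₀ (≤-trans (cofactor≤ 1≤d x≡q₀d) x≤R) ⟩
  w q₀                             ∎
  where
  open ≡-Reasoning
  to : ∀ q → q * d ≡ x → q ≡ q₀
  to q qd≡x = *-cancelʳ-≡ q q₀ d (trans qd≡x x≡q₀d)
  from : ∀ {q} → q ≡ q₀ → q * d ≡ x
  from refl = sym x≡q₀d
  1≤q₀ : 1 ≤ q₀
  1≤q₀ = n≢0⇒n>0 (λ { refl → <⇒≢ 1≤x (sym x≡q₀d) })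

∑-non-multiples : ∀ R {d x} (w : ℕ → ℕ) → ¬ d ∣ x → ∑[ q ≤ R ] (⟦ q * d ≟ x ⟧ * w q) ≡ 0
∑-non-multiples R {d} {x} w d∤x = ∑-zero-∈ R (λ {q} _ _ →
  cong (_* w q) (⟦⟧-no (q * d ≟ x) (λ qd≡x → d∤x (divides q (sym qd≡x)))))

∑-cofactors : ∀ R {d x} → 1 ≤ d → 1 ≤ x → x ≤ R → ∑[ q ≤ R ] ⟦ q * d ≟ x ⟧ ≡ ⟦ d ∣? x ⟧
∑-cofactors R {d} {x} 1≤d 1≤x x≤R = trans (∑-cong R (λ _ → sym (*-identityʳ _))) (count (d ∣? x))
  where
  count : (d∣?x : Dec (d ∣ x)) → ∑[ q ≤ R ] (⟦ q * d ≟ x ⟧ * 1) ≡ ⟦ d∣?x ⟧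
  count (yes (divides q₀ x≡q₀d)) = ∑-multiples R {q₀ = q₀} (λ _ → 1) 1≤d 1≤x x≤R x≡q₀d
  count (no d∤x)                 = ∑-non-multiples R (λ _ → 1) d∤x

∑-divisors : ∀ R (g : ℕ → ℕ) {x} → 1 ≤ x → x ≤ R →
             sum (map g (divisors x)) ≡ ∑[ d ≤ R ] ∑[ q ≤ R ] (⟦ q * d ≟ x ⟧ * g q)
∑-divisors R g {x} 1≤x x≤R = begin
  sum (map g (divisors x))                      ≡⟨ sum-map-filter (_∣? x) g (range1 x) ⟩
  sum (map (λ e → ⟦ e ∣? x ⟧ * g e) (range1 x)) ≡⟨ sum-map-range1 x _ ⟩
  ∑[ e ≤ x ] (⟦ e ∣? x ⟧ * g e)                 ≡⟨ ∑-truncate R _ x≤R non-divisor ⟨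
  ∑[ e ≤ R ] (⟦ e ∣? x ⟧ * g e)
    ≡⟨ ∑-cong-∈ R (λ 1≤e _ → cong (_* g _) (sym (∑-cofactors R 1≤e 1≤x x≤R))) ⟩
  ∑[ e ≤ R ] (∑[ d ≤ R ] ⟦ d * e ≟ x ⟧ * g e)   ≡⟨ ∑-cong R (λ e → *-distribʳ-∑ R (g e) _) ⟩
  ∑[ e ≤ R ] ∑[ d ≤ R ] (⟦ d * e ≟ x ⟧ * g e)   ≡⟨ ∑-comm R R _ ⟩
  ∑[ d ≤ R ] ∑[ e ≤ R ] (⟦ d * e ≟ x ⟧ * g e)
    ≡⟨ ∑²-cong R (λ d e → cong (λ y → ⟦ y ≟ x ⟧ * g e) (*-comm d e)) ⟩
  ∑[ d ≤ R ] ∑[ q ≤ R ] (⟦ q * d ≟ x ⟧ * g q)   ∎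
  where
  open ≡-Reasoning
  non-divisor : ∀ {e} → x < e → e ≤ R → ⟦ e ∣? x ⟧ * g e ≡ 0
  non-divisor {e} x<e _ =
    cong (_* g e) (⟦⟧-no (e ∣? x) (λ e∣x → <⇒≱ x<e (∣⇒≤ ⦃ >-nonZero 1≤x ⦄ e∣x)))

σ₀≡∑² : ∀ R {x} → 1 ≤ x → x ≤ R → σ₀ x ≡ ∑[ d ≤ R ] ∑[ q ≤ R ] (⟦ q * d ≟ x ⟧ * 1)
σ₀≡∑² R {x} 1≤x x≤R = trans (length-as-sum (divisors x)) (∑-divisors R (λ _ → 1) 1≤x x≤R)

σ₁≡∑² : ∀ R {x} → 1 ≤ x → x ≤ R → σ₁ x ≡ ∑[ d ≤ R ] ∑[ q ≤ R ] (⟦ q * d ≟ x ⟧ * q)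
σ₁≡∑² R {x} 1≤x x≤R =
  trans (cong sum (sym (map-id (divisors x)))) (∑-divisors R (λ q → q) 1≤x x≤R)

∑-< : ∀ R {s} → s ≤ suc R → ∑[ c ≤ R ] ⟦ c <? s ⟧ ≡ pred s
∑-< R {zero}  _     = ∑-zero-∈ R (λ {c} _ _ → ⟦⟧-no (c <? 0) (λ ()))
∑-< R {suc s} s<R+1 = begin
  ∑[ c ≤ R ] ⟦ c <? suc s ⟧
    ≡⟨ ∑-truncate R _ (≤-pred s<R+1) (λ {c} s<c _ → ⟦⟧-no (c <? suc s) (<⇒≱ s<c ∘ ≤-pred)) ⟩
  ∑[ c ≤ s ] ⟦ c <? suc s ⟧ ≡⟨ ∑-cong-∈ s (λ {c} _ c≤s → ⟦⟧-yes (c <? suc s) (s≤s c≤s)) ⟩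
  ∑[ c ≤ s ] 1              ≡⟨ ∑-one s ⟩
  s                         ∎
  where open ≡-Reasoning

∑²-compositions : ∀ R {s} → s ≤ R → ∑[ c ≤ R ] ∑[ e ≤ R ] ⟦ c + e ≟ s ⟧ ≡ pred s
∑²-compositions R {s} s≤R = trans (∑-cong R second-parts) (∑-< R (m≤n⇒m≤1+n s≤R))
  where
  second-parts : ∀ c → ∑[ e ≤ R ] ⟦ c + e ≟ s ⟧ ≡ ⟦ c <? s ⟧
  second-parts c with c <? s
  ... | yes c<s =
    trans (∑-cong R (λ e → trans (⟦⟧-⇔ (c + e ≟ s) (e ≟ s ∸ c) to from) (sym (*-identityʳ _))))
          (∑-δ R (λ _ → 1) (m<n⇒0<n∸m c<s) (≤-trans (m∸n≤m s c) s≤R))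
    where
    to : ∀ {e} → c + e ≡ s → e ≡ s ∸ c
    to {e} c+e≡s = trans (sym (m+n∸m≡n c e)) (cong (_∸ c) c+e≡s)
    from : ∀ {e} → e ≡ s ∸ c → c + e ≡ s
    from refl = m+[n∸m]≡n (<⇒≤ c<s)
  ... | no c≮s = ∑-zero-∈ R (λ {e} 1≤e _ →
    ⟦⟧-no (c + e ≟ s) (λ c+e≡s → c≮s (subst (c <_) c+e≡s (m<m+n c 1≤e))))

∑²-scaled-compositions : ∀ R {d x} → 1 ≤ d → 1 ≤ x → x ≤ R →
  ∑[ k ≤ R ] ∑[ l ≤ R ] ⟦ k * d + l * d ≟ x ⟧ ≡ ∑[ q ≤ R ] (⟦ q * d ≟ x ⟧ * pred q)
∑²-scaled-compositions R {d} {x} 1≤d 1≤x x≤R with d ∣? x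
... | yes (divides q₀ x≡q₀d) = begin
  ∑[ k ≤ R ] ∑[ l ≤ R ] ⟦ k * d + l * d ≟ x ⟧
    ≡⟨ ∑²-cong R (λ k l → ⟦⟧-⇔ (k * d + l * d ≟ x) (k + l ≟ q₀) (to k l) (from k l)) ⟩
  ∑[ k ≤ R ] ∑[ l ≤ R ] ⟦ k + l ≟ q₀ ⟧ ≡⟨ ∑²-compositions R (≤-trans (cofactor≤ 1≤d x≡q₀d) x≤R) ⟩
  pred q₀                              ≡⟨ ∑-multiples R {q₀ = q₀} pred 1≤d 1≤x x≤R x≡q₀d ⟨
  ∑[ q ≤ R ] (⟦ q * d ≟ x ⟧ * pred q)  ∎
  where
  open ≡-Reasoning
  to : ∀ k l → k * d + l * d ≡ x → k + l ≡ q₀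
  to k l e = *-cancelʳ-≡ (k + l) q₀ d ⦃ >-nonZero 1≤d ⦄ (trans (*-distribʳ-+ d k l) (trans e x≡q₀d))
  from : ∀ k l → k + l ≡ q₀ → k * d + l * d ≡ x
  from k l refl = trans (sym (*-distribʳ-+ d k l)) (sym x≡q₀d)
... | no d∤x = trans (∑²-zero R not-multiple) (sym (∑-non-multiples R pred d∤x))
  where
  not-multiple : ∀ k l → ⟦ k * d + l * d ≟ x ⟧ ≡ 0
  not-multiple k l = ⟦⟧-no (k * d + l * d ≟ x)
    (λ e → d∤x (divides (k + l) (trans (sym e) (sym (*-distribʳ-+ d k l)))))

odd⇒positive : ∀ {m} → ¬ 2 ∣ m → 1 ≤ m
odd⇒positive {zero}  2∤0 = ⊥-elim (2∤0 (2 ∣0))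
odd⇒positive {suc _} _   = s≤s z≤n

one-factor-even : ∀ q d {m} → ¬ 2 ∣ m → q * d ≡ 2 * m → ⟦ 2 ∣? q ⟧ + ⟦ 2 ∣? d ⟧ ≡ 1
one-factor-even q d {m} 2∤m qd≡2m with 2 ∣? q | 2 ∣? d
... | yes 2∣q | yes 2∣d = ⊥-elim (2∤m (*-cancelˡ-∣ 2 (subst (2 * 2 ∣_) qd≡2m (*-pres-∣ 2∣q 2∣d))))
... | yes _   | no  _   = refl
... | no  _   | yes _   = refl
... | no 2∤q  | no 2∤d  =
  ⊥-elim ([ 2∤q , 2∤d ]′ (euclidsLemma q d prime[2] (divides m (trans qd≡2m (*-comm 2 m)))))

∑-even-cofactors : ∀ R {d m} → 1 ≤ d → 1 ≤ m → 2 * m ≤ R →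
                   ∑[ q ≤ R ] (⟦ q * d ≟ 2 * m ⟧ * ⟦ 2 ∣? q ⟧) ≡ ⟦ d ∣? m ⟧
∑-even-cofactors R {d} {m} 1≤d 1≤m 2m≤R with d ∣? m
... | yes (divides q₀ m≡q₀d) =
  trans (∑-multiples R {q₀ = 2 * q₀} (λ q → ⟦ 2 ∣? q ⟧) 1≤d (≤-trans 1≤m (m≤m+n m (m + 0))) 2m≤R
                     (trans (cong (2 *_) m≡q₀d) (sym (*-assoc 2 q₀ d))))
        (⟦⟧-yes (2 ∣? 2 * q₀) (m∣m*n q₀))
... | no d∤m = ∑-zero-∈ R (λ {q} _ _ → vanish q (2 ∣? q))
  where
  reassoc : ∀ i d → i * 2 * d ≡ 2 * (i * d)
  reassoc = solve-∀
  vanish : ∀ q (2∣?q : Dec (2 ∣ q)) → ⟦ q * d ≟ 2 * m ⟧ * ⟦ 2∣?q ⟧ ≡ 0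
  vanish q        (no _)                 = *-zeroʳ ⟦ q * d ≟ 2 * m ⟧
  vanish .(i * 2) (yes (divides i refl)) = cong (_* 1) (⟦⟧-no (i * 2 * d ≟ 2 * m)
    (λ e → d∤m (divides i (*-cancelˡ-≡ m (i * d) 2 (trans (sym e) (reassoc i d))))))

trichotomy-split : ∀ x y z → z ≡ ⟦ y <? x ⟧ * z + ⟦ x <? y ⟧ * z + ⟦ y ≟ x ⟧ * z
trichotomy-split x y z = begin
  z                                               ≡⟨ *-identityˡ z ⟨
  1 * z                                           ≡⟨ cong (_* z) (trichotomy (<-cmp x y)) ⟨
  (⟦ y <? x ⟧ + ⟦ x <? y ⟧ + ⟦ y ≟ x ⟧) * z       ≡⟨ *-distribʳ-+ z (⟦ y <? x ⟧ + ⟦ x <? y ⟧) _ ⟩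
  (⟦ y <? x ⟧ + ⟦ x <? y ⟧) * z + ⟦ y ≟ x ⟧ * z   ≡⟨ cong (_+ ⟦ y ≟ x ⟧ * z) (*-distribʳ-+ z ⟦ y <? x ⟧ _) ⟩
  ⟦ y <? x ⟧ * z + ⟦ x <? y ⟧ * z + ⟦ y ≟ x ⟧ * z ∎
  where
  open ≡-Reasoning
  trichotomy : Tri (x < y) (x ≡ y) (y < x) → ⟦ y <? x ⟧ + ⟦ x <? y ⟧ + ⟦ y ≟ x ⟧ ≡ 1
  trichotomy (tri< x<y x≢y y≮x)
    rewrite ⟦⟧-no (y <? x) y≮x | ⟦⟧-yes (x <? y) x<y | ⟦⟧-no (y ≟ x) (x≢y ∘ sym) = refl
  trichotomy (tri≈ x≮x refl _)
    rewrite ⟦⟧-no (x <? x) x≮x | ⟦⟧-yes (x ≟ x) refl = refl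
  trichotomy (tri> x≮y x≢y y<x)
    rewrite ⟦⟧-yes (y <? x) y<x | ⟦⟧-no (x <? y) x≮y | ⟦⟧-no (y ≟ x) (x≢y ∘ sym) = refl

∑²-sym-split : ∀ n (F : ℕ → ℕ → ℕ) → (∀ x y → F x y ≡ F y x) →
               ∑² n F ≡ 2 * ∑² n (λ x y → ⟦ y <? x ⟧ * F x y) + ∑[ x ≤ n ] F x x
∑²-sym-split n F F-sym = begin
  ∑² n F
    ≡⟨ ∑²-cong n (λ x y → trichotomy-split x y (F x y)) ⟩
  ∑² n (λ x y → ⟦ y <? x ⟧ * F x y + ⟦ x <? y ⟧ * F x y + ⟦ y ≟ x ⟧ * F x y)
    ≡⟨ trans (∑²-distrib-+ n _ _) (cong (_+ diagonal) (∑²-distrib-+ n _ _)) ⟩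
  below + above + diagonal
    ≡⟨ cong₂ (λ s t → below + s + t) above≡below diagonal≡ ⟩
  below + below + ∑[ x ≤ n ] F x x
    ≡⟨ cong (λ s → below + s + ∑[ x ≤ n ] F x x) (+-identityʳ below) ⟨
  2 * below + ∑[ x ≤ n ] F x x ∎
  where
  open ≡-Reasoning
  below above diagonal : ℕ
  below    = ∑² n (λ x y → ⟦ y <? x ⟧ * F x y)
  above    = ∑² n (λ x y → ⟦ x <? y ⟧ * F x y)
  diagonal = ∑² n (λ x y → ⟦ y ≟ x ⟧ * F x y)
  above≡below : above ≡ below
  above≡below = trans (∑-comm n n _) (∑²-cong n (λ x y → cong (⟦ y <? x ⟧ *_) (F-sym y x)))
  diagonal≡ : diagonal ≡ ∑[ x ≤ n ] F x x
  diagonal≡ = ∑-cong-∈ n (λ 1≤x x≤n → ∑-δ n (F _) 1≤x x≤n)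

-- Split first by comparing a with c and then, on a = c, by comparing b with d.
∑²-pairs-sym-split : ∀ n (F : ℕ → ℕ → ℕ → ℕ → ℕ) → (∀ a b c d → F a b c d ≡ F c d a b) →
  ∃[ S ] ∑² n (λ a b → ⟦ b <? a ⟧ * ∑² n (λ c d → ⟦ d <? c ⟧ * F a b c d))
         ≡ 2 * S + ∑² n (λ a b → ⟦ b <? a ⟧ * F a b a b)
∑²-pairs-sym-split n F F-sym = off-diagonal + ∑ n X , (begin
  ∑² n (λ a b → ⟦ b <? a ⟧ * ∑² n (λ c d → ⟦ d <? c ⟧ * F a b c d))
    ≡⟨ ∑²-cong n (λ a b → *-distribˡ-∑² n ⟦ b <? a ⟧ _) ⟩
  ∑[ a ≤ n ] ∑[ b ≤ n ] ∑[ c ≤ n ] ∑[ d ≤ n ] (⟦ b <? a ⟧ * (⟦ d <? c ⟧ * F a b c d))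
    ≡⟨ ∑-cong n (λ a → ∑-comm n n _) ⟩
  ∑² n G
    ≡⟨ ∑²-sym-split n G G-sym ⟩
  2 * off-diagonal + ∑[ a ≤ n ] G a a
    ≡⟨ cong (2 * off-diagonal +_) (∑-cong n diagonal-split) ⟩
  2 * off-diagonal + ∑[ a ≤ n ] (2 * X a + ∑[ b ≤ n ] (⟦ b <? a ⟧ * F a b a b))
    ≡⟨ cong (2 * off-diagonal +_) (trans (∑-distrib-+ n _ _) (cong (_+ M) (sym (*-distribˡ-∑ n 2 X)))) ⟩
  2 * off-diagonal + (2 * ∑ n X + M)
    ≡⟨ +-assoc (2 * off-diagonal) (2 * ∑ n X) M ⟨
  2 * off-diagonal + 2 * ∑ n X + M
    ≡⟨ cong (_+ M) (*-distribˡ-+ 2 off-diagonal (∑ n X)) ⟨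
  2 * (off-diagonal + ∑ n X) + M ∎)
  where
  open ≡-Reasoning
  M : ℕ
  M = ∑² n (λ a b → ⟦ b <? a ⟧ * F a b a b)
  G : ℕ → ℕ → ℕ
  G a c = ∑² n (λ b d → ⟦ b <? a ⟧ * (⟦ d <? c ⟧ * F a b c d))
  G-sym : ∀ a c → G a c ≡ G c a
  G-sym a c = trans (∑-comm n n _) (∑²-cong n (λ b d →
    trans (m*[n*o]≡n*[m*o] ⟦ d <? a ⟧ ⟦ b <? c ⟧ _)
          (cong (λ t → ⟦ b <? c ⟧ * (⟦ d <? a ⟧ * t)) (F-sym a d c b))))
  off-diagonal : ℕ
  off-diagonal = ∑² n (λ a c → ⟦ c <? a ⟧ * G a c)
  K : ℕ → ℕ → ℕ → ℕ
  K a b d = ⟦ b <? a ⟧ * (⟦ d <? a ⟧ * F a b a d)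
  K-sym : ∀ a b d → K a b d ≡ K a d b
  K-sym a b d = trans (m*[n*o]≡n*[m*o] ⟦ b <? a ⟧ ⟦ d <? a ⟧ _)
                      (cong (λ t → ⟦ d <? a ⟧ * (⟦ b <? a ⟧ * t)) (F-sym a b a d))
  X : ℕ → ℕ
  X a = ∑² n (λ b d → ⟦ d <? b ⟧ * K a b d)
  diagonal-split : ∀ a → G a a ≡ 2 * X a + ∑[ b ≤ n ] (⟦ b <? a ⟧ * F a b a b)
  diagonal-split a = trans (∑²-sym-split n (K a) (K-sym a))
                           (cong (2 * X a +_) (∑-cong n (λ b → ⟦⟧-idem (b <? a) _)))

module Representations (N : ℕ) where

  rep : ℕ → ℕ → ℕ → ℕ → ℕ
  rep a b c d = ⟦ a * b + c * d ≟ N ⟧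

  rep-swapˡ : ∀ a b c d → rep a b c d ≡ rep b a c d
  rep-swapˡ a b c d = cong (λ t → ⟦ t + c * d ≟ N ⟧) (*-comm a b)

  rep-swapʳ : ∀ a b c d → rep a b c d ≡ rep a b d c
  rep-swapʳ a b c d = cong (λ t → ⟦ a * b + t ≟ N ⟧) (*-comm c d)

  rep-swap : ∀ a b c d → rep a b c d ≡ rep c d a b
  rep-swap a b c d = cong (λ t → ⟦ t ≟ N ⟧) (+-comm (a * b) (c * d))

  reps square-reps square-reps< double-reps double-reps< : ℕ
  reps         = ∑² N (λ a b → ∑² N (rep a b))
  square-reps  = ∑[ a ≤ N ] ∑² N (rep a a)
  square-reps< = ∑[ a ≤ N ] ∑² N (λ c d → ⟦ d <? c ⟧ * rep a a c d)
  double-reps  = ∑² N (λ a b → rep a b a b)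
  double-reps< = ∑² N (λ a b → ⟦ b <? a ⟧ * rep a b a b)

  parts : ℕ → ℕ → ℕ
  parts n₁ n₂ = ∑² N (λ k₁ k₂ → ⟦ k₁ * n₁ + k₂ * n₂ ≟ N ⟧)

  equal-parts : ℕ
  equal-parts = ∑[ n ≤ N ] parts n n

  parts-sym : ∀ n₁ n₂ → parts n₁ n₂ ≡ parts n₂ n₁
  parts-sym n₁ n₂ = trans (∑-comm N N _)
    (∑²-cong N (λ k₂ k₁ → cong (λ t → ⟦ t ≟ N ⟧) (+-comm (k₁ * n₁) (k₂ * n₂))))

  ∑²-parts≡reps : ∑² N parts ≡ reps
  ∑²-parts≡reps = trans (∑-cong N (λ n₁ → ∑-comm N N _)) (∑²-cong N (λ n₁ k₁ → ∑²-cong N (λ n₂ k₂ →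
    cong (λ t → ⟦ t ≟ N ⟧) (cong₂ _+_ (*-comm k₁ n₁) (*-comm k₂ n₂)))))

  ⟦twoPartCond⟧ : ∀ n₁ n₂ k₁ k₂ →
    ⟦ twoPartCond? N (n₁ , n₂ , k₁ , k₂) ⟧ ≡ ⟦ n₂ <? n₁ ⟧ * ⟦ k₁ * n₁ + k₂ * n₂ ≟ N ⟧
  ⟦twoPartCond⟧ n₁ n₂ k₁ k₂ with n₂ <? n₁ | k₁ * n₁ + k₂ * n₂ ≟ N
  ... | yes _ | yes _ = refl
  ... | yes _ | no  _ = refl
  ... | no  _ | _     = refl

  ν₂≡∑ : ν₂ N ≡ ∑² N (λ n₁ n₂ → ⟦ n₂ <? n₁ ⟧ * parts n₁ n₂)
  ν₂≡∑ = begin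
    ν₂ N                                        ≡⟨ length-filter (twoPartCond? N) (quadruples N) ⟩
    sum (map χ (quadruples N))                  ≡⟨ sum-map-quadruples N χ ⟩
    ∑² N (λ n₁ n₂ → ∑² N (λ k₁ k₂ → χ (n₁ , n₂ , k₁ , k₂)))
      ≡⟨ ∑²-cong N (λ n₁ n₂ → trans (∑²-cong N (⟦twoPartCond⟧ n₁ n₂))
                                    (sym (*-distribˡ-∑² N ⟦ n₂ <? n₁ ⟧ _))) ⟩
    ∑² N (λ n₁ n₂ → ⟦ n₂ <? n₁ ⟧ * parts n₁ n₂) ∎
    where
    open ≡-Reasoning
    χ : ℕ × ℕ × ℕ × ℕ → ℕ
    χ q = ⟦ twoPartCond? N q ⟧

  reps≡2ν₂+equal-parts : reps ≡ 2 * ν₂ N + equal-parts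
  reps≡2ν₂+equal-parts = begin
    reps                                                          ≡⟨ ∑²-parts≡reps ⟨
    ∑² N parts                                                    ≡⟨ ∑²-sym-split N parts parts-sym ⟩
    2 * ∑² N (λ n₁ n₂ → ⟦ n₂ <? n₁ ⟧ * parts n₁ n₂) + equal-parts ≡⟨ cong (λ t → 2 * t + equal-parts) ν₂≡∑ ⟨
    2 * ν₂ N + equal-parts                                        ∎
    where open ≡-Reasoning

  equal-parts+σ₀≡σ₁ : 1 ≤ N → equal-parts + σ₀ N ≡ σ₁ N
  equal-parts+σ₀≡σ₁ 1≤N = begin
    equal-parts + σ₀ N
      ≡⟨ cong₂ _+_ (∑-cong-∈ N (λ 1≤d _ → ∑²-scaled-compositions N 1≤d 1≤N ≤-refl)) (σ₀≡∑² N 1≤N ≤-refl) ⟩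
    ∑² N (λ d q → ⟦ q * d ≟ N ⟧ * pred q) + ∑² N (λ d q → ⟦ q * d ≟ N ⟧ * 1)
      ≡⟨ ∑²-distrib-+ N _ _ ⟨
    ∑² N (λ d q → ⟦ q * d ≟ N ⟧ * pred q + ⟦ q * d ≟ N ⟧ * 1)
      ≡⟨ ∑-cong N (λ d → ∑-cong-∈ N (λ {q} 1≤q _ → pred-then-suc ⟦ q * d ≟ N ⟧ 1≤q)) ⟩
    ∑² N (λ d q → ⟦ q * d ≟ N ⟧ * q)
      ≡⟨ σ₁≡∑² N 1≤N ≤-refl ⟨
    σ₁ N ∎
    where
    open ≡-Reasoning
    pred-then-suc : ∀ y {q} → 1 ≤ q → y * pred q + y * 1 ≡ y * q
    pred-then-suc y {suc q} _ = trans (sym (*-distribˡ-+ y q 1)) (cong (y *_) (+-comm q 1))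

  sumσ₀≡square-reps : sumσ₀ N ≡ square-reps
  sumσ₀≡square-reps = begin
    sumσ₀ N                                      ≡⟨ sum-map-filter (λ a → a * a <? N) _ (range1 N) ⟩
    sum (map (λ a → ⟦ a * a <? N ⟧ * σ₀ (N ∸ a * a)) (range1 N))
                                                 ≡⟨ sum-map-range1 N _ ⟩
    ∑[ a ≤ N ] (⟦ a * a <? N ⟧ * σ₀ (N ∸ a * a)) ≡⟨ ∑-cong N (λ a → σ₀-complement a (a * a <? N)) ⟩
    square-reps                                  ∎
    where
    open ≡-Reasoning
    σ₀-complement : ∀ a (a²<?N : Dec (a * a < N)) → ⟦ a²<?N ⟧ * σ₀ (N ∸ a * a) ≡ ∑² N (rep a a)
    σ₀-complement a (yes a²<N) = begin
      σ₀ (N ∸ a * a) + 0                       ≡⟨ +-identityʳ _ ⟩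
      σ₀ (N ∸ a * a)                           ≡⟨ σ₀≡∑² N (m<n⇒0<n∸m a²<N) (m∸n≤m N (a * a)) ⟩
      ∑² N (λ c d → ⟦ d * c ≟ N ∸ a * a ⟧ * 1) ≡⟨ ∑²-cong N shift ⟩
      ∑² N (rep a a)                           ∎
      where
      to : ∀ c d → d * c ≡ N ∸ a * a → a * a + c * d ≡ N
      to c d e = trans (cong (a * a +_) (trans (*-comm c d) e)) (m+[n∸m]≡n (<⇒≤ a²<N))
      from : ∀ c d → a * a + c * d ≡ N → d * c ≡ N ∸ a * a
      from c d e = trans (*-comm d c) (trans (sym (m+n∸m≡n (a * a) (c * d))) (cong (_∸ a * a) e))
      shift : ∀ c d → ⟦ d * c ≟ N ∸ a * a ⟧ * 1 ≡ rep a a c d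
      shift c d = trans (*-identityʳ _)
        (⟦⟧-⇔ (d * c ≟ N ∸ a * a) (a * a + c * d ≟ N) (to c d) (from c d))
    σ₀-complement a (no a²≮N) = sym (∑-zero-∈ N (λ 1≤c _ → ∑-zero-∈ N (λ 1≤d _ →
      ⟦⟧-no (a * a + _ ≟ N) (λ e → <-irrefl refl
        (≤-<-trans (≮⇒≥ a²≮N) (subst (a * a <_) e (m<m+n (a * a) (*-mono-≤ 1≤c 1≤d))))))))

  reps-orbit-split : ∃[ S ] reps ≡ 8 * S + 4 * double-reps< + 2 * square-reps< + square-reps
  reps-orbit-split with ∑²-pairs-sym-split N rep rep-swap
  ... | S , S₂≡ = S , (begin
    reps
      ≡⟨ ∑²-sym-split N (λ a b → ∑² N (rep a b)) (λ a b → ∑²-cong N (rep-swapˡ a b)) ⟩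
    2 * S₁ + square-reps            ≡⟨ cong (λ t → 2 * t + square-reps) S₁≡ ⟩
    2 * (2 * S₂ + T₁) + square-reps ≡⟨ cong₂ (λ s t → 2 * (2 * s + t) + square-reps) S₂≡ T₁≡square-reps< ⟩
    2 * (2 * (2 * S + double-reps<) + square-reps<) + square-reps
                                    ≡⟨ regroup S double-reps< square-reps< square-reps ⟩
    8 * S + 4 * double-reps< + 2 * square-reps< + square-reps ∎)
    where
    open ≡-Reasoning
    S₁ S₂ T₁ : ℕ
    S₁ = ∑² N (λ a b → ⟦ b <? a ⟧ * ∑² N (rep a b))
    S₂ = ∑² N (λ a b → ⟦ b <? a ⟧ * ∑² N (λ c d → ⟦ d <? c ⟧ * rep a b c d))
    T₁ = ∑² N (λ a b → ⟦ b <? a ⟧ * ∑[ c ≤ N ] rep a b c c)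
    distrib : ∀ x y z → x * (2 * y + z) ≡ 2 * (x * y) + x * z
    distrib = solve-∀
    regroup : ∀ s m t u → 2 * (2 * (2 * s + m) + t) + u ≡ 8 * s + 4 * m + 2 * t + u
    regroup = solve-∀
    S₁≡ : S₁ ≡ 2 * S₂ + T₁
    S₁≡ = begin
      S₁
        ≡⟨ ∑²-cong N (λ a b → cong (⟦ b <? a ⟧ *_) (∑²-sym-split N (rep a b) (rep-swapʳ a b))) ⟩
      ∑² N (λ a b → ⟦ b <? a ⟧ * (2 * ∑² N (λ c d → ⟦ d <? c ⟧ * rep a b c d) + ∑[ c ≤ N ] rep a b c c))
        ≡⟨ ∑²-cong N (λ a b → distrib ⟦ b <? a ⟧ _ _) ⟩
      ∑² N (λ a b → 2 * (⟦ b <? a ⟧ * ∑² N (λ c d → ⟦ d <? c ⟧ * rep a b c d))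
                    + ⟦ b <? a ⟧ * ∑[ c ≤ N ] rep a b c c)
        ≡⟨ ∑²-distrib-+ N _ _ ⟩
      ∑² N (λ a b → 2 * (⟦ b <? a ⟧ * ∑² N (λ c d → ⟦ d <? c ⟧ * rep a b c d))) + T₁
        ≡⟨ cong (_+ T₁) (*-distribˡ-∑² N 2 _) ⟨
      2 * S₂ + T₁ ∎
    T₁≡square-reps< : T₁ ≡ square-reps<
    T₁≡square-reps< = begin
      T₁
        ≡⟨ ∑²-cong N (λ a b → *-distribˡ-∑ N ⟦ b <? a ⟧ _) ⟩
      ∑[ a ≤ N ] ∑[ b ≤ N ] ∑[ c ≤ N ] (⟦ b <? a ⟧ * rep a b c c) ≡⟨ ∑-cong N (λ a → ∑-comm N N _) ⟩
      ∑[ a ≤ N ] ∑[ c ≤ N ] ∑[ b ≤ N ] (⟦ b <? a ⟧ * rep a b c c) ≡⟨ ∑-comm N N _ ⟩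
      ∑[ c ≤ N ] ∑[ a ≤ N ] ∑[ b ≤ N ] (⟦ b <? a ⟧ * rep a b c c)
        ≡⟨ ∑-cong N (λ c → ∑²-cong N (λ a b → cong (⟦ b <? a ⟧ *_) (rep-swap a b c c))) ⟩
      square-reps< ∎

  σ₀≡2*double-reps : ∀ {m} → N ≡ 2 * m → ¬ 2 ∣ m → σ₀ N ≡ 2 * double-reps
  σ₀≡2*double-reps {m} refl 2∤m = begin
    σ₀ N                             ≡⟨ σ₀≡∑² N 1≤N ≤-refl ⟩
    ∑² N (λ d q → ⟦ q * d ≟ N ⟧ * 1) ≡⟨ ∑²-cong N (λ d q → split q d) ⟩
    ∑² N (λ d q → ⟦ q * d ≟ N ⟧ * ⟦ 2 ∣? q ⟧ + ⟦ q * d ≟ N ⟧ * ⟦ 2 ∣? d ⟧)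
                                     ≡⟨ ∑²-distrib-+ N _ _ ⟩
    even-cofactor + even-divisor
      ≡⟨ cong (even-cofactor +_) (trans even-divisor≡even-cofactor (sym (+-identityʳ _))) ⟩
    2 * even-cofactor                ≡⟨ cong (2 *_) (trans even-cofactor≡ (sym double-reps≡)) ⟩
    2 * double-reps                  ∎
    where
    open ≡-Reasoning
    1≤m : 1 ≤ m
    1≤m = odd⇒positive 2∤m
    m≤N : m ≤ N
    m≤N = m≤m+n m (m + 0)
    1≤N : 1 ≤ N
    1≤N = ≤-trans 1≤m m≤N
    split : ∀ q d → ⟦ q * d ≟ N ⟧ * 1 ≡ ⟦ q * d ≟ N ⟧ * ⟦ 2 ∣? q ⟧ + ⟦ q * d ≟ N ⟧ * ⟦ 2 ∣? d ⟧
    split q d with q * d ≟ N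
    ... | yes qd≡N = trans (sym (one-factor-even q d 2∤m qd≡N))
                           (sym (cong₂ _+_ (*-identityˡ ⟦ 2 ∣? q ⟧) (*-identityˡ ⟦ 2 ∣? d ⟧)))
    ... | no  _    = refl
    even-cofactor even-divisor : ℕ
    even-cofactor = ∑² N (λ d q → ⟦ q * d ≟ N ⟧ * ⟦ 2 ∣? q ⟧)
    even-divisor  = ∑² N (λ d q → ⟦ q * d ≟ N ⟧ * ⟦ 2 ∣? d ⟧)
    even-divisor≡even-cofactor : even-divisor ≡ even-cofactor
    even-divisor≡even-cofactor =
      trans (∑-comm N N _) (∑²-cong N (λ x y → cong (λ t → ⟦ t ≟ N ⟧ * ⟦ 2 ∣? y ⟧) (*-comm x y)))
    even-cofactor≡ : even-cofactor ≡ ∑[ d ≤ N ] ⟦ d ∣? m ⟧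
    even-cofactor≡ = ∑-cong-∈ N (λ 1≤d _ → ∑-even-cofactors N 1≤d 1≤m ≤-refl)
    doubling : ∀ a b → a * b + a * b ≡ 2 * (b * a)
    doubling = solve-∀
    double-reps≡ : double-reps ≡ ∑[ d ≤ N ] ⟦ d ∣? m ⟧
    double-reps≡ = ∑-cong-∈ N (λ {a} 1≤a _ →
      trans (∑-cong N (λ b → ⟦⟧-⇔ (a * b + a * b ≟ N) (b * a ≟ m)
                                  (λ e → *-cancelˡ-≡ (b * a) m 2 (trans (sym (doubling a b)) e))
                                  (λ e → trans (doubling a b) (cong (2 *_) e))))
            (∑-cofactors N 1≤a 1≤m m≤N))

  module _ (no-two-squares : ∀ a b → a * a + b * b ≢ N) where

    square-reps≡2*square-reps< : square-reps ≡ 2 * square-reps<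
    square-reps≡2*square-reps< = begin
      square-reps                                              ≡⟨ ∑-cong N halve ⟩
      ∑[ a ≤ N ] (2 * ∑² N (λ c d → ⟦ d <? c ⟧ * rep a a c d)) ≡⟨ *-distribˡ-∑ N 2 _ ⟨
      2 * square-reps<                                         ∎
      where
      open ≡-Reasoning
      halve : ∀ a → ∑² N (rep a a) ≡ 2 * ∑² N (λ c d → ⟦ d <? c ⟧ * rep a a c d)
      halve a = trans (∑²-sym-split N (rep a a) (rep-swapʳ a a))
        (trans (cong (2 * ∑² N (λ c d → ⟦ d <? c ⟧ * rep a a c d) +_)
                     (∑-zero-∈ N (λ {c} _ _ → ⟦⟧-no (a * a + c * c ≟ N) (no-two-squares a c))))
               (+-identityʳ _))

    double-reps≡2*double-reps< : double-reps ≡ 2 * double-reps<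
    double-reps≡2*double-reps< =
      trans (∑²-sym-split N (λ a b → rep a b a b) (λ a b → trans (rep-swapˡ a b a b) (rep-swapʳ b a a b)))
            (trans (cong (2 * double-reps< +_)
                         (∑-zero-∈ N (λ {a} _ _ → ⟦⟧-no (a * a + a * a ≟ N) (no-two-squares a a))))
                   (+-identityʳ _))

half-of-sum : ∀ ν σ k → 2 * ν + σ ≡ 2 * k → ν + σ / 2 ≡ k
half-of-sum ν σ k e = begin
  ν + σ / 2         ≡⟨ cong (_+ σ / 2) (m*n/n≡m ν 2) ⟨
  ν * 2 / 2 + σ / 2 ≡⟨ +-distrib-/-∣ˡ σ (divides ν refl) ⟨
  (ν * 2 + σ) / 2   ≡⟨ cong (λ t → (t + σ) / 2) (*-comm ν 2) ⟩
  (2 * ν + σ) / 2   ≡⟨ cong (_/ 2) (trans e (*-comm 2 k)) ⟩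
  k * 2 / 2         ≡⟨ m*n/n≡m k 2 ⟩
  k                 ∎
  where open ≡-Reasoning

combine-mod-4 : ∀ {ν s σ₀ σ₁ E W M T T₀} →
  W ≡ 2 * ν + E → E + σ₀ ≡ σ₁ → ∃[ S ] W ≡ 8 * S + 4 * M + 2 * T + T₀ →
  s ≡ T₀ → T₀ ≡ 2 * T → σ₀ ≡ 2 * (2 * M) → (ν + s + σ₁ / 2) % 4 ≡ 0
combine-mod-4 {ν} {s} {σ₀} {σ₁} {E} {W} {M} {T} {T₀} W≡2ν+E E+σ₀≡σ₁ (S , W≡) s≡T₀ T₀≡2T σ₀≡4M = begin
  (ν + s + σ₁ / 2) % 4 ≡⟨ cong (_% 4) (xy∙z≈xz∙y ν s (σ₁ / 2)) ⟩
  (ν + σ₁ / 2 + s) % 4 ≡⟨ cong₂ (λ t u → (t + u) % 4) (half-of-sum ν σ₁ k 2ν+σ₁≡2k) (trans s≡T₀ T₀≡2T) ⟩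
  (k + 2 * T) % 4      ≡⟨ cong (_% 4) (regroup₂ S M T) ⟩
  (S + M + T) * 4 % 4  ≡⟨ m*n%n≡0 (S + M + T) 4 ⟩
  0                    ∎
  where
  open ≡-Reasoning
  k : ℕ
  k = 4 * S + 4 * M + 2 * T
  regroup₁ : ∀ S M T → 8 * S + 4 * M + 2 * T + 2 * T + 2 * (2 * M) ≡ 2 * (4 * S + 4 * M + 2 * T)
  regroup₁ = solve-∀
  regroup₂ : ∀ S M T → 4 * S + 4 * M + 2 * T + 2 * T ≡ (S + M + T) * 4
  regroup₂ = solve-∀
  2ν+σ₁≡2k : 2 * ν + σ₁ ≡ 2 * k
  2ν+σ₁≡2k = begin
    2 * ν + σ₁                                  ≡⟨ cong (2 * ν +_) E+σ₀≡σ₁ ⟨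
    2 * ν + (E + σ₀)                            ≡⟨ +-assoc (2 * ν) E σ₀ ⟨
    2 * ν + E + σ₀                              ≡⟨ cong₂ _+_ (trans (sym W≡2ν+E) W≡) σ₀≡4M ⟩
    8 * S + 4 * M + 2 * T + T₀ + 2 * (2 * M)    ≡⟨ cong (λ t → 8 * S + 4 * M + 2 * T + t + 2 * (2 * M)) T₀≡2T ⟩
    8 * S + 4 * M + 2 * T + 2 * T + 2 * (2 * M) ≡⟨ regroup₁ S M T ⟩
    2 * k                                       ∎

theorem1p4 : (N m : ℕ) → N ≡ 2 * m → m % 2 ≡ 1
    → ¬ (∃[ a ] ∃[ b ] a * a + b * b ≡ N)
    → (ν₂ N + sumσ₀ N + σ₁ N / 2) % 4 ≡ 0
theorem1p4 N m N≡2m m%2≡1 no-two-squares =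
  combine-mod-4 {ν = ν₂ N} {s = sumσ₀ N} {σ₁ = σ₁ N} {M = double-reps<} {T = square-reps<}
    reps≡2ν₂+equal-parts
    (equal-parts+σ₀≡σ₁ 1≤N)
    reps-orbit-split
    sumσ₀≡square-reps
    (square-reps≡2*square-reps< no-squares)
    (trans (σ₀≡2*double-reps N≡2m 2∤m) (cong (2 *_) (double-reps≡2*double-reps< no-squares)))
  where
  open Representations N
  2∤m : ¬ 2 ∣ m
  2∤m 2∣m = 0≢1+n (trans (sym (n∣m⇒m%n≡0 m 2 2∣m)) m%2≡1)
  1≤N : 1 ≤ N
  1≤N = subst (1 ≤_) (sym N≡2m) (≤-trans (odd⇒positive 2∤m) (m≤m+n m (m + 0)))
  no-squares : ∀ a b → a * a + b * b ≢ N
  no-squares a b e = no-two-squares (a , b , e)
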